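{- There exists a (connected) symmetric configuration $21_3$ which is not upper embeddable in any orientation of triples; that is, it admits no upper embedding at all.
   Context: A symmetric configuration $v_3$ is a pair $(V,\mathcal{B})$ where $V$ is a set of $v$ points and $\mathcal{B}$ is a set of $v$ three-element subsets of $V$ (blocks, or triples) such that each point lies in exactly $3$ blocks and any two distinct points lie in at most one block. Its Levi graph is the bipartite graph with vertex set $V\cup\mathcal{B}$, where a point $p$ is adjacent to a block $B$ iff $p\in B$; configurations are assumed connected, i.e. the Levi graph is connected. The associated graph $K$ has vertex set $V$ and an edge $uv$ for each pair of distinct points lying in a common block. An embedding of the configuration is a cellular embedding of $K$ in a closed orientable surface such that every block triangle bounds a face (a block face); the other faces are outer faces. It is an upper embedding if there is exactly one outer face. An orientation of triples assigns to each block a cyclic order of its three points; the configuration is upper embeddable in that orientation if it has an upper embedding in which the orientation of the surface induces the preassigned cyclic order on every block face. -}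

module Defs where

open import Data.Nat using (ℕ; zero; suc)
open import Data.Fin using (Fin; zero; suc)
open import Data.Bool using (Bool; true; false)
open import Data.Product using (Σ; ∃; _×_; _,_)
open import Data.Sum using (_⊎_)
open import Relation.Nullary using (¬_)
open import Relation.Binary.PropositionalEquality using (_≡_; _≢_)
open import Relation.Binary.Construct.Closure.ReflexiveTransitive using (Star)

-- A candidate configuration on the point set Fin v with v blocks (indexed by Fin v);
-- block b consists of the points  blk b 0, blk b 1, blk b 2.
Blocks : ℕ → Set
Blocks v = Fin v → Fin 3 → Fin v

module _ {v : ℕ} (blk : Blocks v) where

  _∈B_ : Fin v → Fin v → Set
  p ∈B b = ∃ λ i → blk b i ≡ p

  data LeviAdj : Fin v ⊎ Fin v → Fin v ⊎ Fin v → Set where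
    pt→bl : ∀ {p b} → p ∈B b → LeviAdj (Data.Sum.inj₁ p) (Data.Sum.inj₂ b)
    bl→pt : ∀ {p b} → p ∈B b → LeviAdj (Data.Sum.inj₂ b) (Data.Sum.inj₁ p)

  record IsConnectedConfig₃ : Set where
    field
      blockInj   : ∀ b i j → blk b i ≡ blk b j → i ≡ j
      threeBlocks : ∀ p → Σ (Fin 3 → Fin v) λ bs →
                      (∀ k l → bs k ≡ bs l → k ≡ l) ×
                      (∀ k → p ∈B bs k) ×
                      (∀ b → p ∈B b → ∃ λ k → bs k ≡ b)
      -- two distinct points lie in at most one block
      -- (this also forces the v blocks to be distinct subsets)
      atMostOne  : ∀ p q b b' → p ≢ q → p ∈B b → q ∈B b → p ∈B b' → q ∈B b' → b ≡ b'
      connected  : ∀ x y → Star LeviAdj x y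

  Adj : Fin v → Fin v → Set
  Adj u w = (u ≢ w) × (∃ λ b → (u ∈B b) × (w ∈B b))

  -- Rotation system on K: σ u is the successor map of the cyclic order of the
  -- neighbours of u (values at non-neighbours are irrelevant).
  iter : {A : Set} → ℕ → (A → A) → A → A
  iter zero    f x = x
  iter (suc n) f x = f (iter n f x)

  record IsRotation (σ : Fin v → Fin v → Fin v) : Set where
    field
      closed     : ∀ u w → Adj u w → Adj u (σ u w)
      injective  : ∀ u w w' → Adj u w → Adj u w' → σ u w ≡ σ u w' → w ≡ w'
      transitive : ∀ u w w' → Adj u w → Adj u w' → ∃ λ n → iter n (σ u) w ≡ w'

  Dart : Set
  Dart = Fin v × Fin v

  faceStep : (Fin v → Fin v → Fin v) → Dart → Dart
  faceStep σ (u , w) = (w , σ w u)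

  -- orientation of triples: o b = true gives cyclic order (b0 b1 b2),
  -- o b = false gives (b0 b2 b1)
  Orientation : Set
  Orientation = Fin v → Bool

  BlockDart : Orientation → Fin v → Dart → Set
  BlockDart o b (u , w) with o b
  ... | true  = ((u ≡ blk b zero) × (w ≡ blk b (suc zero)))
              ⊎ ((u ≡ blk b (suc zero)) × (w ≡ blk b (suc (suc zero))))
              ⊎ ((u ≡ blk b (suc (suc zero))) × (w ≡ blk b zero))
  ... | false = ((u ≡ blk b zero) × (w ≡ blk b (suc (suc zero))))
              ⊎ ((u ≡ blk b (suc (suc zero))) × (w ≡ blk b (suc zero)))
              ⊎ ((u ≡ blk b (suc zero)) × (w ≡ blk b zero))

  -- each oriented block triangle is a face (an orbit of the face-tracing map)
  BlockFaces : Orientation → (Fin v → Fin v → Fin v) → Set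
  BlockFaces o σ = ∀ b → BlockFacesAt (o b) b
    where
      b0 b1 b2 : Fin v → Fin v
      b0 b = blk b zero
      b1 b = blk b (suc zero)
      b2 b = blk b (suc (suc zero))
      BlockFacesAt : Bool → Fin v → Set
      BlockFacesAt true  b = (σ (b1 b) (b0 b) ≡ b2 b) × (σ (b2 b) (b1 b) ≡ b0 b) × (σ (b0 b) (b2 b) ≡ b1 b)
      BlockFacesAt false b = (σ (b2 b) (b0 b) ≡ b1 b) × (σ (b1 b) (b2 b) ≡ b0 b) × (σ (b0 b) (b1 b) ≡ b2 b)

  OuterDart : Orientation → Dart → Set
  OuterDart o (u , w) = Adj u w × (∀ b → ¬ BlockDart o b (u , w))

  -- exactly one outer face: all outer darts form a single face orbit
  -- (there are always outer darts, since K has 3v edges and only 3v darts lie on block faces)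
  OneOuterFace : Orientation → (Fin v → Fin v → Fin v) → Set
  OneOuterFace o σ = ∀ d e → OuterDart o d → OuterDart o e → ∃ λ n → iter n (faceStep σ) d ≡ e

  -- an upper embedding of the configuration in orientation o
  -- (a rotation system on the connected graph K = a cellular embedding in a
  --  closed orientable surface)
  UpperEmbeddingIn : Orientation → Set
  UpperEmbeddingIn o = Σ (Fin v → Fin v → Fin v) λ σ →
                         IsRotation σ × BlockFaces o σ × OneOuterFace o σ

  UpperEmbeddable : Set
  UpperEmbeddable = Σ Orientation UpperEmbeddingIn

{-# OPTIONS --safe #-}
-- The configuration consists of three copies of the Fano plane with one line removed; the three
-- points of each copy that lost a block (its ports) are joined across the copies by three
-- connector blocks.  In an embedding whose block triangles are faces, the rotation at a point is
-- fixed up to one bit, and the outer faces are the orbits of a walk on corners of blocks.  An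
-- exhaustive search over the 2^13 choices of orientations and rotation bits inside one copy shows
-- that either an outer face stays inside the copy, or the walk leads from each port of the copy
-- to a cyclic shift of it.  A second search, over the 3^3 shifts and the 2^3 orientations of the
-- connectors, shows that the walk through the nine connector corners is then never one cycle.
-- Either way there are at least two outer faces.
module Submission where

open import Defs
open import Agda.Builtin.FromNat using (Number; fromNat)
open import Data.Bool using (Bool; true; false; not; T; _∨_; if_then_else_)
import Data.Bool.Properties as Bool
open import Data.Empty using (⊥; ⊥-elim)
open import Data.Fin using (Fin; zero; suc; toℕ; _↑ˡ_; _↑ʳ_; splitAt; combine; remQuot; _≟_)
import Data.Fin.Literals as Fin
open import Data.Fin.Properties using (all?; any?; remQuot-combine; splitAt-↑ʳ)
open import Data.Maybe using (Maybe; just; nothing)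
import Data.Maybe.Properties as Maybe
open import Data.Nat using (ℕ; zero; suc; _<_; _≤_; z≤n; s≤s)
import Data.Nat.Literals as ℕ
open import Data.Nat.Properties using (≤-refl; <⇒≤; m≤n⇒m<n∨m≡n)
open import Data.Product using (Σ; ∃; ∃₂; _×_; _,_; proj₁; proj₂; map₂; uncurry)
import Data.Product.Properties as Product
open import Data.Sum using (_⊎_; inj₁; inj₂; [_,_]′)
import Data.Sum.Properties as Sum
open import Data.Unit using (⊤; tt)
open import Data.Vec using (Vec; []; _∷_; lookup; tabulate)
open import Data.Vec.Properties using (lookup∘tabulate)
open import Function using (_∘_; const; case_of_)
open import Function.Bundles using (Equivalence)
open import Relation.Binary.Construct.Closure.ReflexiveTransitive using (Star; ε; _◅_; _◅◅_; reverse)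
open import Relation.Binary.Definitions using (DecidableEquality)
open import Relation.Binary.PropositionalEquality
  using (_≡_; _≢_; refl; sym; trans; cong; cong₂; subst; module ≡-Reasoning)
open import Relation.Nullary using (¬_; Dec; yes; does; contradiction)
open import Relation.Nullary.Decidable using (dec-true; map′; ¬?; _×-dec_; _⊎-dec_; _→-dec_)

instance
  finNumber : ∀ {n} → Number (Fin n)
  finNumber = Fin.number _

  natNumber : Number ℕ
  natNumber = ℕ.number

  unit : ⊤
  unit = tt

turn : Bool → Fin 3 → Fin 3
turn true  zero             = suc zero
turn true  (suc zero)       = suc (suc zero)
turn true  (suc (suc zero)) = zero
turn false zero             = suc (suc zero)
turn false (suc zero)       = zero
turn false (suc (suc zero)) = suc zero

turn-turn-not : ∀ t i → turn t (turn (not t) i) ≡ i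
turn-turn-not true  zero             = refl
turn-turn-not true  (suc zero)       = refl
turn-turn-not true  (suc (suc zero)) = refl
turn-turn-not false zero             = refl
turn-turn-not false (suc zero)       = refl
turn-turn-not false (suc (suc zero)) = refl

turn-≢ : ∀ t i → turn t i ≢ i
turn-≢ true  zero             ()
turn-≢ true  (suc zero)       ()
turn-≢ true  (suc (suc zero)) ()
turn-≢ false zero             ()
turn-≢ false (suc zero)       ()
turn-≢ false (suc (suc zero)) ()

turn-turn-≢ : ∀ t i → turn t (turn t i) ≢ i
turn-turn-≢ true  zero             ()
turn-turn-≢ true  (suc zero)       ()
turn-turn-≢ true  (suc (suc zero)) ()
turn-turn-≢ false zero             ()
turn-turn-≢ false (suc zero)       ()
turn-turn-≢ false (suc (suc zero)) ()

turn-cancelʳ : ∀ {t t'} i → turn t i ≡ turn t' i → t ≡ t'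
turn-cancelʳ {true}  {true}  _                _  = refl
turn-cancelʳ {false} {false} _                _  = refl
turn-cancelʳ {true}  {false} zero             ()
turn-cancelʳ {true}  {false} (suc zero)       ()
turn-cancelʳ {true}  {false} (suc (suc zero)) ()
turn-cancelʳ {false} {true}  zero             ()
turn-cancelʳ {false} {true}  (suc zero)       ()
turn-cancelʳ {false} {true}  (suc (suc zero)) ()

turn-onto : ∀ {i k} → i ≢ k → ∃ λ t → k ≡ turn t i
turn-onto {zero}           {zero}           i≢k = ⊥-elim (i≢k refl)
turn-onto {zero}           {suc zero}       _   = true , refl
turn-onto {zero}           {suc (suc zero)} _   = false , refl
turn-onto {suc zero}       {zero}           _   = false , refl
turn-onto {suc zero}       {suc zero}       i≢k = ⊥-elim (i≢k refl)
turn-onto {suc zero}       {suc (suc zero)} _   = true , refl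
turn-onto {suc (suc zero)} {zero}           _   = true , refl
turn-onto {suc (suc zero)} {suc zero}       _   = false , refl
turn-onto {suc (suc zero)} {suc (suc zero)} i≢k = ⊥-elim (i≢k refl)

derangement-turn : (g : Fin 3 → Fin 3) → (∀ i j → g i ≡ g j → i ≡ j) → (∀ i → g i ≢ i) →
                   ∃ λ t → ∀ i → g i ≡ turn t i
derangement-turn g injective fixfree
  with g zero in e₀ | g (suc zero) in e₁ | g (suc (suc zero)) in e₂
... | zero | _ | _ = ⊥-elim (fixfree _ e₀)
... | _ | suc zero | _ = ⊥-elim (fixfree _ e₁)
... | _ | _ | suc (suc zero) = ⊥-elim (fixfree _ e₂)
... | _ | zero | zero = contradiction (injective _ _ (trans e₁ (sym e₂))) λ ()
... | suc zero | _ | suc zero = contradiction (injective _ _ (trans e₀ (sym e₂))) λ ()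
... | suc (suc zero) | suc (suc zero) | _ = contradiction (injective _ _ (trans e₀ (sym e₁))) λ ()
... | suc zero | suc (suc zero) | zero =
  true , λ { zero → e₀ ; (suc zero) → e₁ ; (suc (suc zero)) → e₂ }
... | suc (suc zero) | zero | suc zero =
  false , λ { zero → e₀ ; (suc zero) → e₁ ; (suc (suc zero)) → e₂ }

-- iter (from Defs) takes a configuration argument that it does not use.
module Iteration {v : ℕ} (blk : Blocks v) {A : Set} where

  iter-preserves : (f : A → A) (P : A → Set) → (∀ x → P x → P (f x)) → ∀ n {x} → P x → P (iter blk n f x)
  iter-preserves f P closed zero    px = px
  iter-preserves f P closed (suc n) px = closed _ (iter-preserves f P closed n px)

  iter-conjugate : {B : Set} (f : A → A) {g : B → B} (h : A → B) → (∀ x → g (h x) ≡ h (f x)) →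
                   ∀ n x → iter blk n g (h x) ≡ h (iter blk n f x)
  iter-conjugate f         h commutes zero    x = refl
  iter-conjugate f {g = g} h commutes (suc n) x =
    trans (cong g (iter-conjugate f h commutes n x)) (commutes (iter blk n f x))

  iter-shift : (f : A → A) → ∀ n x → iter blk n f (f x) ≡ iter blk (suc n) f x
  iter-shift f zero    x = refl
  iter-shift f (suc n) x = cong f (iter-shift f n x)

  record ReturnsTo (f : A → A) (P : A → Set) (x y : A) : Set where
    field
      steps  : ℕ
      avoids : ∀ m → m < steps → ¬ P (iter blk (suc m) f x)
      lands  : iter blk (suc steps) f x ≡ y

  -- An orbit started in L passes from L to L, avoiding P in between, so it meets P only inside L.
  unreachable : ∀ (f : A → A) {P t} (L : A → Set) → (∀ x → L x → ∃ λ y → L y × ReturnsTo f P x y) →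
                (∀ x → L x → x ≢ t) → P t → ∀ {x} → L x → ∀ n → iter blk n f x ≢ t
  unreachable f {P} {t} L returns outside pt {x} lx n eq = absurd (position n)
    where
      open ReturnsTo
      segment : ∀ x' (lx' : L x') → ReturnsTo f P x' (proj₁ (returns x' lx'))
      segment x' lx' = proj₂ (proj₂ (returns x' lx'))
      Position : ℕ → Set
      Position n = ∃₂ λ x' (lx' : L x') → ∃ λ m →
        m ≤ steps (segment x' lx') × iter blk n f x ≡ iter blk m f x'
      position : ∀ n → Position n
      position zero = x , lx , zero , z≤n , refl
      position (suc n) with position n
      ... | x' , lx' , m , m≤ , e with m≤n⇒m<n∨m≡n m≤
      ...   | inj₁ m< = x' , lx' , suc m , m< , cong f e
      ...   | inj₂ m≡ = _ , proj₁ (proj₂ (returns x' lx')) , zero , z≤n ,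
                        trans (cong f e) (trans (cong (λ k → iter blk (suc k) f x') m≡) (lands (segment x' lx')))
      absurd : Position n → ⊥
      absurd (x' , lx' , zero , _ , e)   = outside x' lx' (trans (sym e) eq)
      absurd (x' , lx' , suc m , m< , e) = avoids (segment x' lx') m m< (subst P (trans (sym eq) e) pt)

  weaken-avoided : ∀ (f : A → A) {P Q x y} → (∀ z → Q z → P z) → ReturnsTo f P x y → ReturnsTo f Q x y
  weaken-avoided f Q⇒P r = record
    { steps = steps ; avoids = λ m m< → avoids m m< ∘ Q⇒P _ ; lands = lands }
    where open ReturnsTo r

  firstReturn : (f : A → A) → (A → Bool) → ℕ → A → Maybe A
  firstReturn f stop zero    x = nothing
  firstReturn f stop (suc n) x = if stop (f x) then just (f x) else firstReturn f stop n (f x)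

  firstReturn-sound : ∀ (f : A → A) stop n x {y} → firstReturn f stop n x ≡ just y → ReturnsTo f (T ∘ stop) x y
  firstReturn-sound f stop (suc n) x eq with stop (f x) in hit
  ... | true  = record { steps = zero ; avoids = λ _ () ; lands = Maybe.just-injective eq }
  ... | false = record
    { steps  = suc steps
    ; avoids = λ { zero _ → subst T hit
                 ; (suc m) (s≤s m<) → avoids m m< ∘ subst (T ∘ stop) (sym (iter-shift f (suc m) x)) }
    ; lands  = trans (sym (iter-shift f (suc steps) x)) lands
    }
    where open ReturnsTo (firstReturn-sound f stop n (f x) eq)

-- Corners, darts and the outer walk of a configuration

Corner : ℕ → Set
Corner v = Fin v × Fin 3

module _ {v : ℕ} (blk : Blocks v) where

  point : Corner v → Fin v
  point (b , i) = blk b i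

  record CornerEnumeration : Set where
    field
      corner       : Fin v → Fin 3 → Corner v
      slot         : Corner v → Fin 3
      point-corner : ∀ u j → point (corner u j) ≡ u
      corner-slot  : ∀ c → corner (point c) (slot c) ≡ c
      slot-corner  : ∀ u j → slot (corner u j) ≡ j

    shift : Bool → Corner v → Corner v
    shift t (b , i) = b , turn t i

    neighbour : Fin v → Fin 3 → Bool → Fin v
    neighbour u j t = point (shift t (corner u j))

    block-neighbour : ∀ {u w b} → u ≢ w → _∈B_ blk u b → _∈B_ blk w b →
                      ∃₂ λ j t → proj₁ (corner u j) ≡ b × w ≡ neighbour u j t
    block-neighbour {b = b} u≢w (i , refl) (k , refl) with turn-onto {i} {k} (u≢w ∘ cong (blk b))
    ... | t , refl = slot (b , i) , t , cong proj₁ (corner-slot (b , i)) , cong (point ∘ shift t) (sym (corner-slot (b , i)))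

    three-blocks : (∀ b i j → blk b i ≡ blk b j → i ≡ j) → ∀ p →
      Σ (Fin 3 → Fin v) λ bs → (∀ k l → bs k ≡ bs l → k ≡ l) × (∀ k → _∈B_ blk p (bs k)) ×
                               (∀ b → _∈B_ blk p b → ∃ λ k → bs k ≡ b)
    three-blocks blockInj p = proj₁ ∘ corner p , injective , (λ k → proj₂ (corner p k) , point-corner p k) , complete
      where
        same-corner : ∀ {c c'} → point c ≡ point c' → proj₁ c ≡ proj₁ c' → c ≡ c'
        same-corner {b , i} {.b , i'} e refl = cong (b ,_) (blockInj b i i' e)
        injective : ∀ k l → proj₁ (corner p k) ≡ proj₁ (corner p l) → k ≡ l
        injective k l e = trans (sym (slot-corner p k))
          (trans (cong slot (same-corner (trans (point-corner p k) (sym (point-corner p l))) e)) (slot-corner p l))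
        complete : ∀ b → _∈B_ blk p b → ∃ λ k → proj₁ (corner p k) ≡ b
        complete b (i , refl) = slot (b , i) , cong proj₁ (corner-slot (b , i))

    at-most-one-block : (∀ u j j' t t' → neighbour u j t ≡ neighbour u j' t' → j ≡ j') →
                        ∀ p q b b' → p ≢ q → _∈B_ blk p b → _∈B_ blk q b →
                        _∈B_ blk p b' → _∈B_ blk q b' → b ≡ b'
    at-most-one-block distinct p q b b' p≢q pb qb pb' qb'
      with block-neighbour p≢q pb qb | block-neighbour p≢q pb' qb'
    ... | j , t , refl , e | j' , t' , refl , e' = cong (proj₁ ∘ corner p) (distinct p j j' t t' (trans (sym e) e'))

    connected-via : ∀ j t root → (∀ p → ∃ λ n → iter blk n (λ q → neighbour q j t) p ≡ root) →
                    ∀ x y → Star (LeviAdj blk) x y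
    connected-via j t root reaches x y = toRoot x ◅◅ reverse flip (toRoot y)
      where
        flip : ∀ {x y} → LeviAdj blk x y → LeviAdj blk y x
        flip (pt→bl m) = bl→pt m
        flip (bl→pt m) = pt→bl m
        hop : ∀ p → Star (LeviAdj blk) (inj₁ p) (inj₁ (neighbour p j t))
        hop p = pt→bl (_ , point-corner p j) ◅ bl→pt (turn t (proj₂ (corner p j)) , refl) ◅ ε
        route : ∀ n p → Star (LeviAdj blk) (inj₁ p) (inj₁ (iter blk n (λ q → neighbour q j t) p))
        route zero    p = ε
        route (suc n) p = route n p ◅◅ hop _
        toRoot : ∀ x → Star (LeviAdj blk) x (inj₁ root)
        toRoot (inj₁ p) = subst (Star (LeviAdj blk) (inj₁ p) ∘ inj₁) (proj₂ (reaches p)) (route (proj₁ (reaches p)) p)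
        toRoot (inj₂ b) = bl→pt (zero , refl) ◅ toRoot (inj₁ (blk b zero))

module OuterWalk {v : ℕ} {blk : Blocks v} (config : IsConnectedConfig₃ blk) (enum : CornerEnumeration blk) where
  open IsConnectedConfig₃ config
  open CornerEnumeration enum
  open Iteration blk

  successor predecessor : Orientation blk → Corner v → Corner v
  successor   o c = shift (o (proj₁ c)) c
  predecessor o c = shift (not (o (proj₁ c))) c

  rotate : Bool → Corner v → Corner v
  rotate ρ c = corner (point blk c) (turn ρ (slot c))

  outerWalk : Orientation blk → (Fin v → Bool) → Corner v → Corner v
  outerWalk o r c = predecessor o (rotate (r (point blk c)) c)

  -- The corner (b , i) stands for the outer dart that enters blk b i from its successor in b.
  dart : Orientation blk → Corner v → Dart blk
  dart o c = point blk (successor o c) , point blk c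

  successor-predecessor : ∀ o c → successor o (predecessor o c) ≡ c
  successor-predecessor o (b , i) = cong (b ,_) (turn-turn-not (o b) i)

  same-block : ∀ {b b' i i' k k'} → i ≢ k → blk b i ≡ blk b' i' → blk b k ≡ blk b' k' → b ≡ b'
  same-block i≢k e e' = atMostOne _ _ _ _ (i≢k ∘ blockInj _ _ _) (_ , refl) (_ , refl) (_ , sym e) (_ , sym e')

  shift-injective : ∀ {c c' t t'} → point blk c ≡ point blk c' → point blk (shift t c) ≡ point blk (shift t' c') →
                    c ≡ c' × t ≡ t'
  shift-injective {b , i} {b' , i'} {t} e e' with same-block (turn-≢ t i ∘ sym) e e'
  ... | refl with blockInj b i i' e
  ... | refl = refl , turn-cancelʳ i (blockInj b _ _ e')

  neighbour-injective : ∀ u {j j' t t'} → neighbour u j t ≡ neighbour u j' t' → j ≡ j' × t ≡ t'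
  neighbour-injective u {j} {j'} e with shift-injective (trans (point-corner u j) (sym (point-corner u j'))) e
  ... | corners , t≡t' = trans (sym (slot-corner u j)) (trans (cong slot corners) (slot-corner u j')) , t≡t'

  neighbour-≢ : ∀ u j t → u ≢ neighbour u j t
  neighbour-≢ u j t e = turn-≢ t _ (blockInj _ _ _ (trans (sym e) (sym (point-corner u j))))

  neighbour-adjacent : ∀ u j t → Adj blk u (neighbour u j t)
  neighbour-adjacent u j t = neighbour-≢ u j t , _ , (_ , point-corner u j) , (_ , refl)

  adjacent-neighbour : ∀ {u w} → Adj blk u w → ∃₂ λ j t → w ≡ neighbour u j t
  adjacent-neighbour (u≢w , b , ub , wb) with block-neighbour u≢w ub wb
  ... | j , t , _ , e = j , t , e

  dart-injective : ∀ o {c c'} → dart o c ≡ dart o c' → c ≡ c'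
  dart-injective o eq = proj₁ (shift-injective (cong proj₂ eq) (cong proj₁ eq))

  block-dart : ∀ o b {x u} → BlockDart blk o b (x , u) → ∃ λ m → x ≡ blk b m × u ≡ blk b (turn (o b) m)
  block-dart o b h with o b
  ... | true  = case h of λ
    { (inj₁ (ex , eu))        → zero , ex , eu
    ; (inj₂ (inj₁ (ex , eu))) → suc zero , ex , eu
    ; (inj₂ (inj₂ (ex , eu))) → suc (suc zero) , ex , eu
    }
  ... | false = case h of λ
    { (inj₁ (ex , eu))        → zero , ex , eu
    ; (inj₂ (inj₁ (ex , eu))) → suc (suc zero) , ex , eu
    ; (inj₂ (inj₂ (ex , eu))) → suc zero , ex , eu
    }

  dart-outer : ∀ o c → OuterDart blk o (dart o c)
  dart-outer o (b , i) = adjacent , not-block-dart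
    where
      adjacent : Adj blk (blk b (turn (o b) i)) (blk b i)
      adjacent = turn-≢ (o b) i ∘ blockInj b _ _ , b , (_ , refl) , (_ , refl)
      not-block-dart : ∀ b' → ¬ BlockDart blk o b' (dart o (b , i))
      not-block-dart b' h with block-dart o b' h
      ... | m , ex , eu with same-block (turn-≢ (o b) i) ex eu
      ... | refl with blockInj b _ _ ex
      ... | refl = turn-turn-≢ (o b) i (sym (blockInj b _ _ eu))

  module _ {o : Orientation blk} {σ : Fin v → Fin v → Fin v}
           (rotation : IsRotation blk σ) (faces : BlockFaces blk o σ) where
    open IsRotation rotation

    block-face : ∀ c → σ (point blk c) (point blk (predecessor o c)) ≡ point blk (successor o c)
    block-face (b , i) with o b | faces b
    block-face (b , zero)             | true  | _ , _ , e = e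
    block-face (b , suc zero)         | true  | e , _ , _ = e
    block-face (b , suc (suc zero))   | true  | _ , e , _ = e
    block-face (b , zero)             | false | _ , _ , e = e
    block-face (b , suc zero)         | false | _ , e , _ = e
    block-face (b , suc (suc zero))   | false | e , _ , _ = e

    module AtPoint (u : Fin v) where
      before after : Fin 3 → Fin v
      before j = point blk (predecessor o (corner u j))
      after  j = point blk (successor o (corner u j))

      before-or-after : ∀ j t → neighbour u j t ≡ before j ⊎ neighbour u j t ≡ after j
      before-or-after j t with o (proj₁ (corner u j))
      before-or-after j true  | true  = inj₂ refl
      before-or-after j false | true  = inj₁ refl
      before-or-after j true  | false = inj₁ refl
      before-or-after j false | false = inj₂ refl

      before-injective : ∀ {j j'} → before j ≡ before j' → j ≡ j'
      before-injective = proj₁ ∘ neighbour-injective u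

      after-injective : ∀ {j j'} → after j ≡ after j' → j ≡ j'
      after-injective = proj₁ ∘ neighbour-injective u

      before≢after : ∀ j j' → before j ≢ after j'
      before≢after j j' e with neighbour-injective u e
      ... | refl , t≡t' = Bool.not-¬ refl (sym t≡t')

      σ-before : ∀ j → σ u (before j) ≡ after j
      σ-before j = subst (λ w → σ w (before j) ≡ after j) (point-corner u j) (block-face (corner u j))

      σ-after : ∀ j → ∃ λ k → σ u (after j) ≡ before k
      σ-after j with adjacent-neighbour (closed u _ (neighbour-adjacent u j _))
      ... | k , t , e with before-or-after k t
      ...   | inj₁ e' = k , trans e e'
      ...   | inj₂ e' = ⊥-elim (before≢after k j (sym (injective u _ _ (neighbour-adjacent u j _) (neighbour-adjacent u k _)
                          (trans (trans e e') (sym (σ-before k))))))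

      -- Otherwise {before j , after j} would be an orbit of σ u, cut off from the rest of the neighbourhood.
      σ-after-≢ : ∀ j → σ u (after j) ≢ before j
      σ-after-≢ j e with transitive u (before j) (before (turn true j)) (neighbour-adjacent u j _) (neighbour-adjacent u _ _)
      ... | n , reach with subst Pair reach (iter-preserves (σ u) Pair pair-closed n (inj₁ refl))
        where
          Pair : Fin v → Set
          Pair w = w ≡ before j ⊎ w ≡ after j
          pair-closed : ∀ w → Pair w → Pair (σ u w)
          pair-closed _ (inj₁ refl) = inj₂ (σ-before j)
          pair-closed _ (inj₂ refl) = inj₁ e
      ... | inj₁ e' = turn-≢ true j (before-injective e')
      ... | inj₂ e' = before≢after _ j e'

      exchange : Fin 3 → Fin 3
      exchange = proj₁ ∘ σ-after

      σ-after-exchange : ∀ j → σ u (after j) ≡ before (exchange j)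
      σ-after-exchange = proj₂ ∘ σ-after

      exchange-injective : ∀ j j' → exchange j ≡ exchange j' → j ≡ j'
      exchange-injective j j' e = after-injective (injective u _ _ (neighbour-adjacent u j _) (neighbour-adjacent u j' _)
        (trans (σ-after-exchange j) (trans (cong before e) (sym (σ-after-exchange j')))))

      exchange-fixfree : ∀ j → exchange j ≢ j
      exchange-fixfree j e = σ-after-≢ j (trans (σ-after-exchange j) (cong before e))

      rotation-turns : ∃ λ ρ → ∀ j → σ u (after j) ≡ before (turn ρ j)
      rotation-turns with derangement-turn exchange exchange-injective exchange-fixfree
      ... | ρ , exchange≡ = ρ , λ j → trans (σ-after-exchange j) (cong before (exchange≡ j))

    rotationBit : Fin v → Bool
    rotationBit u = proj₁ (AtPoint.rotation-turns u)

    faceStep-dart : ∀ c → faceStep blk σ (dart o c) ≡ dart o (outerWalk o rotationBit c)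
    faceStep-dart c = cong₂ _,_ (sym arrival) departure
      where
        arrival : point blk (successor o (outerWalk o rotationBit c)) ≡ point blk c
        arrival = trans (cong (point blk) (successor-predecessor o _)) (point-corner _ _)
        departure : σ (point blk c) (point blk (successor o c)) ≡ point blk (outerWalk o rotationBit c)
        departure = subst (λ c' → σ (point blk c) (point blk (successor o c')) ≡ point blk (outerWalk o rotationBit c))
                          (corner-slot c) (proj₂ (AtPoint.rotation-turns (point blk c)) (slot c))

  outerWalk-transitive : ∀ {o} → UpperEmbeddingIn blk o →
                         ∃ λ r → ∀ c c' → ∃ λ n → iter blk n (outerWalk o r) c ≡ c'
  outerWalk-transitive {o} (σ , rotation , faces , oneOuterFace) = r , reach
    where
      r : Fin v → Bool
      r = rotationBit rotation faces
      reach : ∀ c c' → ∃ λ n → iter blk n (outerWalk o r) c ≡ c'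
      reach c c' = map₂ (λ {n} → dart-injective o ∘ trans (sym (dart-iter n c)))
                        (oneOuterFace (dart o c) (dart o c') (dart-outer o c) (dart-outer o c'))
        where
          dart-iter : ∀ n c → iter blk n (faceStep blk σ) (dart o c) ≡ dart o (iter blk n (outerWalk o r) c)
          dart-iter = iter-conjugate (outerWalk o r) (dart o) (faceStep-dart rotation faces)

decide : {A : Set} (a? : Dec A) → does a? ≡ true → A
decide (yes a) _ = a

all-Bool? : {P : Bool → Set} → (∀ b → Dec (P b)) → Dec (∀ b → P b)
all-Bool? P? = map′ (λ { (t , f) true → t ; (t , f) false → f }) (λ h → h true , h false) (P? true ×-dec P? false)

all-Vec? : {A : Set} → (∀ {P : A → Set} → (∀ a → Dec (P a)) → Dec (∀ a → P a)) →
           ∀ n {P : Vec A n → Set} → (∀ v → Dec (P v)) → Dec (∀ v → P v)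
all-Vec? all-A? zero    P? = map′ (λ { p [] → p }) (λ h → h []) (P? [])
all-Vec? all-A? (suc n) P? = map′ (λ { h (a ∷ v) → h a v }) (λ h a v → h (a ∷ v))
                                  (all-A? λ a → all-Vec? all-A? n λ v → P? (a ∷ v))

-- The gadget: a Fano plane without one line

-- Lines are {m+1, m+2, m+4} (mod 7) for m < 6; the missing line {0, 1, 3} consists of the ports.
-- A state is a corner of a line or, as inj₂ p, the connector corner at port p.  Slot j at point k
-- is position j of the line k − (1, 2, 4)ⱼ, or the connector corner if that line is the missing one.
module Gadget where

  line : Fin 6 → Fin 3 → Fin 7
  line = lookup ∘ lookup lines
    where
      lines : Vec (Vec (Fin 7) 3) 6
      lines = (1 ∷ 2 ∷ 4 ∷ []) ∷ (2 ∷ 3 ∷ 5 ∷ []) ∷ (3 ∷ 4 ∷ 6 ∷ []) ∷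
              (4 ∷ 5 ∷ 0 ∷ []) ∷ (5 ∷ 6 ∷ 1 ∷ []) ∷ (6 ∷ 0 ∷ 2 ∷ []) ∷ []

  port : Fin 3 → Fin 7
  port = lookup (0 ∷ 1 ∷ 3 ∷ [])

  State : Set
  State = (Fin 6 × Fin 3) ⊎ Fin 3

  pointOf : State → Fin 7
  pointOf (inj₁ (m , i)) = line m i
  pointOf (inj₂ p)       = port p

  slot : State → Fin 3
  slot (inj₁ (_ , i)) = i
  slot (inj₂ p)       = p

  link : Fin 7 → Fin 3 → State
  link = lookup ∘ lookup links
    where
      links : Vec (Vec State 3) 7
      links = (inj₂ 0 ∷ inj₁ (5 , 1) ∷ inj₁ (3 , 2) ∷ []) ∷
              (inj₁ (0 , 0) ∷ inj₂ 1 ∷ inj₁ (4 , 2) ∷ []) ∷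
              (inj₁ (1 , 0) ∷ inj₁ (0 , 1) ∷ inj₁ (5 , 2) ∷ []) ∷
              (inj₁ (2 , 0) ∷ inj₁ (1 , 1) ∷ inj₂ 2 ∷ []) ∷
              (inj₁ (3 , 0) ∷ inj₁ (2 , 1) ∷ inj₁ (0 , 2) ∷ []) ∷
              (inj₁ (4 , 0) ∷ inj₁ (3 , 1) ∷ inj₁ (1 , 2) ∷ []) ∷
              (inj₁ (5 , 0) ∷ inj₁ (4 , 1) ∷ inj₁ (2 , 2) ∷ []) ∷ []

  rotate : Bool → State → State
  rotate ρ s = link (pointOf s) (turn ρ (slot s))

  predecessor : Vec Bool 6 → State → State
  predecessor ob (inj₁ (m , i)) = inj₁ (m , turn (not (lookup ob m)) i)
  predecessor ob (inj₂ p)       = inj₂ p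

  walk : Vec Bool 6 → Vec Bool 7 → State → State
  walk ob rb s = predecessor ob (rotate (lookup rb (pointOf s)) s)

  isPort : State → Bool
  isPort (inj₁ _) = false
  isPort (inj₂ _) = true

-- The configuration: three gadgets joined by three connectors

gadgetPoint : Fin 3 → Fin 7 → Fin 21
gadgetPoint = combine

gadgetBlock : Fin 3 → Fin 6 → Fin 21
gadgetBlock g m = combine g m ↑ˡ 3

connector : Fin 3 → Fin 21
connector κ = 18 ↑ʳ κ

Port : Set
Port = Fin 3 × Fin 3

_≟ₚ_ : DecidableEquality Port
_≟ₚ_ = Product.≡-dec _≟_ _≟_

connectorPort : Fin 3 → Fin 3 → Port
connectorPort = lookup ∘ lookup wiring
  where
    wiring : Vec (Vec Port 3) 3
    wiring = ((0 , 0) ∷ (0 , 1) ∷ (1 , 0) ∷ []) ∷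
             ((0 , 2) ∷ (2 , 0) ∷ (2 , 1) ∷ []) ∷
             ((1 , 1) ∷ (1 , 2) ∷ (2 , 2) ∷ []) ∷ []

-- The wiring table is symmetric, so it is its own inverse (see portConnector-connectorPort).
portConnector : Port → Fin 3 × Fin 3
portConnector = uncurry connectorPort

configuration : Blocks 21
configuration b = blockPoint (splitAt 18 {3} b)
  where
    blockPoint : Fin 18 ⊎ Fin 3 → Fin 3 → Fin 21
    blockPoint (inj₁ b′) i = uncurry (λ g m → gadgetPoint g (Gadget.line m i)) (remQuot {3} 6 b′)
    blockPoint (inj₂ κ)  i = uncurry (λ g p → gadgetPoint g (Gadget.port p)) (connectorPort κ i)

portCorner : Port → Corner 21
portCorner q = connector (proj₁ (portConnector q)) , proj₂ (portConnector q)

embed : Fin 3 → Gadget.State → Corner 21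
embed g (inj₁ (m , i)) = gadgetBlock g m , i
embed g (inj₂ p)       = portCorner (g , p)

corner : Fin 21 → Fin 3 → Corner 21
corner u j = uncurry (λ g k → embed g (Gadget.link k j)) (remQuot {3} 7 u)

slot : Corner 21 → Fin 3
slot (b , i) = [ const i , (λ κ → proj₂ (connectorPort κ i)) ]′ (splitAt 18 {3} b)

_≟ᶜ_ : DecidableEquality (Corner 21)
_≟ᶜ_ = Product.≡-dec _≟_ _≟_

enumeration : CornerEnumeration configuration
enumeration = record
  { corner       = corner
  ; slot         = slot
  ; point-corner = decide (all? λ u → all? λ j → point configuration (corner u j) ≟ u) refl
  ; corner-slot  = λ c → decide (all? λ b → all? λ i → corner (configuration b i) (slot (b , i)) ≟ᶜ (b , i)) refl
                               (proj₁ c) (proj₂ c)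
  ; slot-corner  = decide (all? λ u → all? λ j → slot (corner u j) ≟ j) refl
  }

blocks-injective : ∀ b i j → configuration b i ≡ configuration b j → i ≡ j
blocks-injective = decide (all? λ b → all? λ i → all? λ j → (configuration b i ≟ configuration b j) →-dec (i ≟ j)) refl

open CornerEnumeration enumeration using (neighbour; three-blocks; at-most-one-block; connected-via)

neighbours-distinct : ∀ u j j' t t' → neighbour u j t ≡ neighbour u j' t' → j ≡ j'
neighbours-distinct = decide (all? λ u → all? λ j → all? λ j' → all-Bool? λ t → all-Bool? λ t' →
  (neighbour u j t ≟ neighbour u j' t') →-dec (j ≟ j')) refl

route-reaches-origin : ∀ p → ∃ λ n → iter configuration n (λ q → neighbour q 0 false) p ≡ 0
route-reaches-origin p = toℕ (proj₁ found) , proj₂ found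
  where
    found : ∃ λ (n : Fin 21) → iter configuration (toℕ n) (λ q → neighbour q 0 false) p ≡ 0
    found = decide (all? λ p → any? λ (n : Fin 21) → iter configuration (toℕ n) (λ q → neighbour q 0 false) p ≟ 0) refl p

configuration-isConnectedConfig₃ : IsConnectedConfig₃ configuration
configuration-isConnectedConfig₃ = record
  { blockInj    = blocks-injective
  ; threeBlocks = three-blocks blocks-injective
  ; atMostOne   = at-most-one-block neighbours-distinct
  ; connected   = connected-via 0 false 0 route-reaches-origin
  }

-- Exhaustive analysis of one gadget

turnBy : Fin 3 → Fin 3 → Fin 3
turnBy zero             = λ p → p
turnBy (suc zero)       = turn true
turnBy (suc (suc zero)) = turn false

_≟ˢ_ : DecidableEquality Gadget.State
_≟ˢ_ = Sum.≡-dec (Product.≡-dec _≟_ _≟_) _≟_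

_≟ᵐ_ : DecidableEquality (Maybe Gadget.State)
_≟ᵐ_ = Maybe.≡-dec _≟ˢ_

open Iteration configuration

-- Opaque, so that types mentioning these searches are never normalised on symbolic bits.
-- The fuel 20 exceeds the 18 corners of a gadget.
opaque
  segmentEnd : Vec Bool 6 → Vec Bool 7 → Fin 3 → Maybe Gadget.State
  segmentEnd ob rb p = firstReturn (Gadget.walk ob rb) Gadget.isPort 20 (inj₂ p)

  portOr : Gadget.State → Gadget.State → Bool
  portOr s₀ s = Gadget.isPort s ∨ does (s ≟ˢ s₀)

  cycleEnd : Vec Bool 6 → Vec Bool 7 → Fin 6 → Fin 3 → Maybe Gadget.State
  cycleEnd ob rb m i = firstReturn (Gadget.walk ob rb) (portOr (inj₁ (m , i))) 20 (inj₁ (m , i))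

GadgetOutcome : Vec Bool 6 → Vec Bool 7 → Set
GadgetOutcome ob rb = (∃ λ e → ∀ p → segmentEnd ob rb p ≡ just (inj₂ (turnBy e p)))
                    ⊎ (∃₂ λ m i → cycleEnd ob rb m i ≡ just (inj₁ (m , i)))

opaque
  unfolding segmentEnd cycleEnd

  segmentEnd-sound : ∀ ob rb p {t} → segmentEnd ob rb p ≡ just t →
                     ReturnsTo (Gadget.walk ob rb) (T ∘ Gadget.isPort) (inj₂ p) t
  segmentEnd-sound ob rb p = firstReturn-sound (Gadget.walk ob rb) Gadget.isPort 20 (inj₂ p)

  cycleEnd-sound : ∀ ob rb m i {t} → cycleEnd ob rb m i ≡ just t →
                   ReturnsTo (Gadget.walk ob rb) (T ∘ Gadget.isPort) (inj₁ (m , i)) t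
  cycleEnd-sound ob rb m i = weaken-avoided (Gadget.walk ob rb) (λ _ → Equivalence.from Bool.T-∨ ∘ inj₁)
                           ∘ firstReturn-sound (Gadget.walk ob rb) (portOr (inj₁ (m , i))) 20 (inj₁ (m , i))

  gadgetOutcome? : ∀ ob rb → Dec (GadgetOutcome ob rb)
  gadgetOutcome? ob rb = (any? λ e → all? λ p → segmentEnd ob rb p ≟ᵐ just (inj₂ (turnBy e p)))
    ⊎-dec (any? λ m → any? λ i → cycleEnd ob rb m i ≟ᵐ just (inj₁ (m , i)))

  gadget-outcomes-decided : does (all-Vec? all-Bool? 6 λ ob → all-Vec? all-Bool? 7 λ rb → gadgetOutcome? ob rb) ≡ true
  gadget-outcomes-decided = refl

-- Opaque so that it never unfolds into the search; the decided proposition is restated verbatim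
-- so that checking it does not re-run the search either.
opaque
  gadget-outcome : ∀ ob rb → GadgetOutcome ob rb
  gadget-outcome = decide (all-Vec? all-Bool? 6 λ ob → all-Vec? all-Bool? 7 λ rb → gadgetOutcome? ob rb)
                          gadget-outcomes-decided

isConnector : Fin 21 → Bool
isConnector b = [ const false , const true ]′ (splitAt 18 {3} b)

AtConnector : Corner 21 → Set
AtConnector c = T (isConnector (proj₁ c))

all-State? : {P : Gadget.State → Set} → (∀ s → Dec (P s)) → Dec (∀ s → P s)
all-State? P? = map′ (λ { (inside , ports) (inj₁ (m , i)) → inside m i ; (inside , ports) (inj₂ p) → ports p })
                     (λ h → (λ m i → h (inj₁ (m , i))) , h ∘ inj₂)
                     ((all? λ m → all? λ i → P? (inj₁ (m , i))) ×-dec (all? λ p → P? (inj₂ p)))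

all-Port? : {P : Port → Set} → (∀ q → Dec (P q)) → Dec (∀ q → P q)
all-Port? P? = map′ (λ h q → h (proj₁ q) (proj₂ q)) (λ h g p → h (g , p)) (all? λ g → all? λ p → P? (g , p))

any-Port? : {P : Port → Set} → (∀ q → Dec (P q)) → Dec (∃ P)
any-Port? P? = map′ (λ (g , p , x) → (g , p) , x) (λ ((g , p) , x) → g , p , x) (any? λ g → any? λ p → P? (g , p))

point-embed : ∀ g s → point configuration (embed g s) ≡ gadgetPoint g (Gadget.pointOf s)
point-embed = decide (all? λ g → all-State? λ s → point configuration (embed g s) ≟ gadgetPoint g (Gadget.pointOf s)) refl

slot-embed : ∀ g s → slot (embed g s) ≡ Gadget.slot s
slot-embed = decide (all? λ g → all-State? λ s → slot (embed g s) ≟ Gadget.slot s) refl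

connector-embed : ∀ g s → isConnector (proj₁ (embed g s)) ≡ Gadget.isPort s
connector-embed = decide (all? λ g → all-State? λ s → isConnector (proj₁ (embed g s)) Bool.≟ Gadget.isPort s) refl

corner-gadgetPoint : ∀ g k j → corner (gadgetPoint g k) j ≡ embed g (Gadget.link k j)
corner-gadgetPoint g k j = cong (uncurry λ g k → embed g (Gadget.link k j)) (remQuot-combine g k)

portConnector-connectorPort : ∀ κ i → portConnector (connectorPort κ i) ≡ (κ , i)
portConnector-connectorPort = decide (all? λ κ → all? λ i → portConnector (connectorPort κ i) ≟ₚ (κ , i)) refl

portCorner-injective : ∀ q q' → portCorner q ≡ portCorner q' → q ≡ q'
portCorner-injective = decide (all-Port? λ q → all-Port? λ q' → (portCorner q ≟ᶜ portCorner q') →-dec (q ≟ₚ q')) refl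

portCorner-atConnector : ∀ q → AtConnector (portCorner q)
portCorner-atConnector q rewrite splitAt-↑ʳ 18 3 (proj₁ (portConnector q)) = tt

open OuterWalk configuration-isConnectedConfig₃ enumeration

gadgetOrientation : Orientation configuration → Fin 3 → Vec Bool 6
gadgetOrientation o g = tabulate (o ∘ gadgetBlock g)

gadgetRotation : (Fin 21 → Bool) → Fin 3 → Vec Bool 7
gadgetRotation r g = tabulate (r ∘ gadgetPoint g)

-- Where the walk of the configuration is when the model walk is in state s: from the
-- connector corner of a port it moves on along the connector.
exit : Orientation configuration → Fin 3 → Gadget.State → Corner 21
exit o g (inj₁ x) = embed g (inj₁ x)
exit o g (inj₂ q) = predecessor o (portCorner (g , q))

exit-internal : ∀ {o g} s → ¬ T (Gadget.isPort s) → exit o g s ≡ embed g s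
exit-internal (inj₁ _) _        = refl
exit-internal (inj₂ _) not-port = ⊥-elim (not-port tt)

rotate-embed : ∀ g ρ s → rotate ρ (embed g s) ≡ embed g (Gadget.rotate ρ s)
rotate-embed g ρ s =
  trans (cong₂ (λ u j → corner u (turn ρ j)) (point-embed g s) (slot-embed g s)) (corner-gadgetPoint g _ _)

predecessor-embed : ∀ o g s → predecessor o (embed g s) ≡ exit o g (Gadget.predecessor (gadgetOrientation o g) s)
predecessor-embed o g (inj₁ (m , i)) =
  cong (λ θ → gadgetBlock g m , turn (not θ) i) (sym (lookup∘tabulate (o ∘ gadgetBlock g) m))
predecessor-embed o g (inj₂ p)       = refl

walk-embed : ∀ o r g s →
  outerWalk o r (embed g s) ≡ exit o g (Gadget.walk (gadgetOrientation o g) (gadgetRotation r g) s)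
walk-embed o r g s = begin
  predecessor o (rotate (r (point configuration (embed g s))) (embed g s))
    ≡⟨ cong (λ ρ′ → predecessor o (rotate ρ′ (embed g s))) rotation-agrees ⟩
  predecessor o (rotate ρ (embed g s))
    ≡⟨ cong (predecessor o) (rotate-embed g ρ s) ⟩
  predecessor o (embed g (Gadget.rotate ρ s))
    ≡⟨ predecessor-embed o g (Gadget.rotate ρ s) ⟩
  exit o g (Gadget.walk (gadgetOrientation o g) (gadgetRotation r g) s) ∎
  where
    open ≡-Reasoning
    ρ : Bool
    ρ = lookup (gadgetRotation r g) (Gadget.pointOf s)
    rotation-agrees : r (point configuration (embed g s)) ≡ ρ
    rotation-agrees = trans (cong r (point-embed g s)) (sym (lookup∘tabulate (r ∘ gadgetPoint g) (Gadget.pointOf s)))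

returns-embed : ∀ o r g {s t} →
  ReturnsTo (Gadget.walk (gadgetOrientation o g) (gadgetRotation r g)) (T ∘ Gadget.isPort) s t →
  ReturnsTo (outerWalk o r) AtConnector (embed g s) (exit o g t)
returns-embed o r g {s} {t} returning = record
  { steps  = steps
  ; avoids = λ m m< → avoids m m< ∘ subst T (connector-embed g _) ∘ subst AtConnector (tracks (suc m) m<)
  ; lands  = trans (cong F (tracks steps ≤-refl))
                   (trans (walk-embed o r g (iter configuration steps G s)) (cong (exit o g) lands))
  }
  where
    open ReturnsTo returning
    F : Corner 21 → Corner 21
    F = outerWalk o r
    G : Gadget.State → Gadget.State
    G = Gadget.walk (gadgetOrientation o g) (gadgetRotation r g)
    tracks : ∀ m → m ≤ steps → iter configuration m F (embed g s) ≡ embed g (iter configuration m G s)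
    tracks zero    _  = refl
    tracks (suc m) m< = trans (cong F (tracks m (<⇒≤ m<)))
                              (trans (walk-embed o r g (iter configuration m G s)) (exit-internal _ (avoids m m<)))

Transfers : Orientation configuration → (Fin 21 → Bool) → Fin 3 → Set
Transfers o r g = ∃ λ e → ∀ p →
  ReturnsTo (outerWalk o r) AtConnector (portCorner (g , p)) (predecessor o (portCorner (g , turnBy e p)))

Traps : Orientation configuration → (Fin 21 → Bool) → Set
Traps o r = ∃ λ c → ¬ AtConnector c × ReturnsTo (outerWalk o r) AtConnector c c

gadget-dichotomy : ∀ o r g → Transfers o r g ⊎ Traps o r
gadget-dichotomy o r g with gadget-outcome (gadgetOrientation o g) (gadgetRotation r g)
... | inj₁ (e , ends)     = inj₁ (e , λ p → returns-embed o r g (segmentEnd-sound _ _ p (ends p)))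
... | inj₂ (m , i , back) = inj₂ (embed g (inj₁ (m , i)) , subst T (connector-embed g (inj₁ (m , i))) ,
                                   returns-embed o r g (cycleEnd-sound _ _ m i back))

-- Gluing the gadgets

crossConnector : (Fin 3 → Bool) → Port → Port
crossConnector θ = cross ∘ portConnector
  where
    cross : Fin 3 × Fin 3 → Port
    cross (κ , i) = connectorPort κ (turn (not (θ κ)) i)

transfer : (Fin 3 → Fin 3) → Port → Port
transfer e (g , p) = g , turnBy (e g) p

nextPort : (Fin 3 → Fin 3) → (Fin 3 → Bool) → Port → Port
nextPort e θ = crossConnector θ ∘ transfer e

predecessor-portCorner : ∀ o q → predecessor o (portCorner q) ≡ portCorner (crossConnector (o ∘ connector) q)
predecessor-portCorner o q = cong (λ c → connector (proj₁ c) , proj₂ c) (sym (portConnector-connectorPort _ _))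

portOrBase : Port → Port → Bool
portOrBase t q = does (q ≟ₚ t) ∨ does (q ≟ₚ (0 , 0))

-- The orbit of (0 , 0) closes up, within the nine ports, without meeting t.
OrbitMisses : (Port → Port) → Set
OrbitMisses R = ∃ λ t → t ≢ (0 , 0) × firstReturn R (portOrBase t) 9 (0 , 0) ≡ just (0 , 0)

_≟ᵖᵐ_ : DecidableEquality (Maybe Port)
_≟ᵖᵐ_ = Maybe.≡-dec _≟ₚ_

orbitMisses? : ∀ R → Dec (OrbitMisses R)
orbitMisses? R = any-Port? λ t → ¬? (t ≟ₚ (0 , 0)) ×-dec (firstReturn R (portOrBase t) 9 (0 , 0) ≟ᵖᵐ just (0 , 0))

opaque
  nextPort-misses : ∀ (e : Vec (Fin 3) 3) (θ : Vec Bool 3) → OrbitMisses (nextPort (lookup e) (lookup θ))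
  nextPort-misses =
    decide (all-Vec? all? 3 λ e → all-Vec? all-Bool? 3 λ θ → orbitMisses? (nextPort (lookup e) (lookup θ))) refl

Intransitive : Orientation configuration → (Fin 21 → Bool) → Set
Intransitive o r = ∃₂ λ c c' → ∀ n → iter configuration n (outerWalk o r) c ≢ c'

trap⇒intransitive : ∀ o r → Traps o r → Intransitive o r
trap⇒intransitive o r (c , internal , cycle) =
  c , portCorner (0 , 0) ,
  unreachable (outerWalk o r) (_≡ c) (λ { _ refl → c , refl , cycle })
    (λ { _ refl eq → internal (subst AtConnector (sym eq) (portCorner-atConnector (0 , 0))) })
    (portCorner-atConnector (0 , 0)) refl

crossConnector-cong : ∀ {θ θ'} → (∀ κ → θ κ ≡ θ' κ) → ∀ q → crossConnector θ q ≡ crossConnector θ' q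
crossConnector-cong θ≗θ' q = cong (λ b → connectorPort κ (turn (not b) i)) (θ≗θ' κ)
  where
    κ : Fin 3
    κ = proj₁ (portConnector q)
    i : Fin 3
    i = proj₂ (portConnector q)

orbitMisses-unreachable : ∀ R → OrbitMisses R → ∃ λ t → ∀ n → iter configuration n R (0 , 0) ≢ t
orbitMisses-unreachable R (t , t≢base , back) = t , unreachable R {P = _≡ t} (_≡ (0 , 0))
  (λ { _ refl → (0 , 0) , refl , weaken-avoided R stops-at-t (firstReturn-sound R (portOrBase t) 9 (0 , 0) back) })
  (λ { _ refl → t≢base ∘ sym }) refl refl
  where
    stops-at-t : ∀ q → q ≡ t → T (portOrBase t q)
    stops-at-t _ refl = Equivalence.from Bool.T-∨ (inj₁ (subst T (sym (dec-true (t ≟ₚ t) refl)) tt))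

transfers⇒intransitive : ∀ o r → (∀ g → Transfers o r g) → Intransitive o r
transfers⇒intransitive o r transfers =
  portCorner (0 , 0) , portCorner t , unreachable F L returns outside (portCorner-atConnector t) (0 , refl)
  where
    F : Corner 21 → Corner 21
    F = outerWalk o r
    e : Fin 3 → Fin 3
    e = proj₁ ∘ transfers
    θ : Fin 3 → Bool
    θ = o ∘ connector
    R : Port → Port
    R = nextPort (lookup (tabulate e)) (lookup (tabulate θ))
    missed : ∃ λ t → ∀ n → iter configuration n R (0 , 0) ≢ t
    missed = orbitMisses-unreachable R (nextPort-misses (tabulate e) (tabulate θ))
    t : Port
    t = proj₁ missed

    lands-at : ∀ g p → predecessor o (portCorner (g , turnBy (e g) p)) ≡ portCorner (R (g , p))
    lands-at g p = trans (predecessor-portCorner o (g , turnBy (e g) p)) (cong portCorner (trans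
      (crossConnector-cong (λ κ → sym (lookup∘tabulate θ κ)) (g , turnBy (e g) p))
      (cong (λ e′ → crossConnector (lookup (tabulate θ)) (g , turnBy e′ p)) (sym (lookup∘tabulate e g)))))

    L : Corner 21 → Set
    L c = ∃ λ n → c ≡ portCorner (iter configuration n R (0 , 0))

    returns : ∀ c → L c → ∃ λ c' → L c' × ReturnsTo F AtConnector c c'
    returns _ (n , refl) = portCorner (R q) , (suc n , refl) ,
      subst (ReturnsTo F AtConnector (portCorner q)) (lands-at (proj₁ q) (proj₂ q))
            (proj₂ (transfers (proj₁ q)) (proj₂ q))
      where
        q : Port
        q = iter configuration n R (0 , 0)

    outside : ∀ c → L c → c ≢ portCorner t
    outside _ (n , refl) = proj₂ missed n ∘ portCorner-injective (iter configuration n R (0 , 0)) t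

outerWalk-intransitive : ∀ o r → Intransitive o r
outerWalk-intransitive o r with gadget-dichotomy o r 0 | gadget-dichotomy o r 1 | gadget-dichotomy o r 2
... | inj₂ trap | _         | _         = trap⇒intransitive o r trap
... | inj₁ _    | inj₂ trap | _         = trap⇒intransitive o r trap
... | inj₁ _    | inj₁ _    | inj₂ trap = trap⇒intransitive o r trap
... | inj₁ t₀   | inj₁ t₁   | inj₁ t₂   =
  transfers⇒intransitive o r λ { zero → t₀ ; (suc zero) → t₁ ; (suc (suc zero)) → t₂ }

configuration-not-upper-embeddable : ¬ UpperEmbeddable configuration
configuration-not-upper-embeddable (o , upper) =
  let r , reach      = outerWalk-transitive upper
      c , c' , never = outerWalk-intransitive o r
  in never (proj₁ (reach c c')) (proj₂ (reach c c'))

theorem2p1 : Σ (Blocks 21) λ blk → IsConnectedConfig₃ blk × ¬ UpperEmbeddable blk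
theorem2p1 = configuration , configuration-isConnectedConfig₃ , configuration-not-upper-embeddable
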